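{- Let $G$ be a finite transitive permutation group on $\Omega$ and let $H_G$ be the subgroup generated by all elements of $G$ fixing at least one point of $\Omega$. Suppose that $H_G$ is a proper subgroup of $G$ containing no derangements. Then $G$ has the EKR-module property.
   Context: A derangement is an element with no fixed point. A subset $\mathcal{F}\subseteq G$ is intersecting if for all $g,h\in\mathcal{F}$ some $\omega\in\Omega$ has $\omega^g=\omega^h$. For $\omega,\omega'\in\Omega$ let $G_{\omega\to\omega'}=\{g\in G:\omega^g=\omega'\}$ (the canonical intersecting sets). $G$ has the EKR-module property if the characteristic vector (in $\mathbb{R}^G$) of every intersecting set of maximum size is a linear combination of the characteristic vectors of the canonical intersecting sets. -}

module Defs where

open import Data.Nat using (ℕ; zero; suc; _≤_)
open import Data.Fin using (Fin; zero; suc)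
open import Data.Fin.Subset using (Subset; _∈_; ∣_∣)
open import Data.Fin.Subset.Properties using (_∈?_)
open import Data.Fin.Properties using (_≟_)
open import Data.Rational using (ℚ; 0ℚ; 1ℚ; _+_; _*_)
open import Data.Product using (Σ; ∃; ∃-syntax; _×_)
open import Relation.Binary.PropositionalEquality using (_≡_; _≢_)
open import Relation.Nullary using (¬_; yes; no)
open import Function.Definitions using (Injective)

-- A finite permutation group G on Ω = Fin n, with elements enumerated
-- without repetition as elt : Fin m → (Fin n → Fin n).
-- Right action: ω^g = elt g ω ; product g·h acts as ω ↦ (ω^g)^h.
record PermGroup (n : ℕ) : Set where
  field
    m        : ℕ
    elt      : Fin m → Fin n → Fin n
    isPerm   : ∀ g → Injective _≡_ _≡_ (elt g)
    distinct : ∀ g h → g ≢ h → ∃[ ω ] elt g ω ≢ elt h ω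
    hasId    : ∃[ e ] (∀ ω → elt e ω ≡ ω)
    closed   : ∀ g h → ∃[ k ] (∀ ω → elt k ω ≡ elt h (elt g ω))
    hasInv   : ∀ g → ∃[ k ] (∀ ω → elt k (elt g ω) ≡ ω)

module _ {n : ℕ} (G : PermGroup n) where
  open PermGroup G

  Transitive : Set
  Transitive = ∀ ω ω' → ∃[ g ] elt g ω ≡ ω'

  FixesSomePoint : Fin m → Set
  FixesSomePoint g = ∃[ ω ] elt g ω ≡ ω

  Derangement : Fin m → Set
  Derangement g = ¬ FixesSomePoint g

  data InH : Fin m → Set where
    gen : ∀ {g} → FixesSomePoint g → InH g
    one : ∀ {e} → (∀ ω → elt e ω ≡ ω) → InH e
    mul : ∀ {g h k} → InH g → InH h → (∀ ω → elt k ω ≡ elt h (elt g ω)) → InH k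
    inv : ∀ {g k} → InH g → (∀ ω → elt k (elt g ω) ≡ ω) → InH k

  ProperH : Set
  ProperH = ∃[ g ] ¬ InH g

  HNoDerangement : Set
  HNoDerangement = ∀ g → InH g → ¬ Derangement g

  Intersecting : Subset m → Set
  Intersecting F = ∀ g h → g ∈ F → h ∈ F → ∃[ ω ] elt g ω ≡ elt h ω

  MaxIntersecting : Subset m → Set
  MaxIntersecting F = Intersecting F × (∀ F' → Intersecting F' → ∣ F' ∣ ≤ ∣ F ∣)

  charVec : Subset m → Fin m → ℚ
  charVec F g with g ∈? F
  ... | yes _ = 1ℚ
  ... | no _  = 0ℚ

  canonVec : Fin n → Fin n → Fin m → ℚ
  canonVec ω ω' g with elt g ω ≟ ω'
  ... | yes _ = 1ℚ
  ... | no _  = 0ℚ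

sumℚ : ∀ {k} → (Fin k → ℚ) → ℚ
sumℚ {zero}  f = 0ℚ
sumℚ {suc k} f = f zero + sumℚ (λ i → f (suc i))

module _ {n : ℕ} (G : PermGroup n) where
  open PermGroup G

  InCanonicalSpan : (Fin m → ℚ) → Set
  InCanonicalSpan v = Σ (Fin n → Fin n → ℚ) λ c → (∀ g → v g ≡ sumℚ (λ ω → sumℚ (λ ω' → c ω ω' * canonVec G ω ω' g)))

  EKRModule : Set
  EKRModule = ∀ F → MaxIntersecting G F → InCanonicalSpan (charVec G F)

-- Call g and h agreeing if they send some point to the same place. Since H_G
-- has no derangements, agreement is transitive: f, g agree iff f·g⁻¹ fixes a
-- point, so f·g⁻¹ and h·g⁻¹ lie in H_G, hence so does their quotient
-- (f·g⁻¹)(h·g⁻¹)⁻¹, which therefore fixes a point; cancelling g⁻¹ shows that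
-- f and h agree. A maximum intersecting set F is then closed under agreement
-- with its members, so whether g ∈ F depends only on ω₀^g for a chosen point ω₀, and
-- charVec F = Σ_{ω'} [some member of F sends ω₀ to ω'] · canonVec ω₀ ω'.
module Submission where

open import Defs
open import Data.Nat using (ℕ; zero; suc; _<_)
open import Data.Nat.Properties using (<⇒≱)
open import Data.Fin using (Fin; zero; suc)
open import Data.Fin.Subset using (Subset; _∈_; _∪_; ⁅_⁆; ∣_∣)
open import Data.Fin.Subset.Properties
  using (_∈?_; p⊂q⇒∣p∣<∣q∣; p⊆p∪q; x∈p∪q⁺; x∈p∪q⁻; x∈⁅x⁆; x∈⁅y⁆⇒x≡y)
open import Data.Fin.Properties using (_≟_; any?; suc-injective)
open import Data.Rational using (ℚ; 0ℚ; 1ℚ; _*_)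
open import Data.Rational.Properties using (+-identityˡ; +-identityʳ; *-zeroˡ; *-zeroʳ; *-identityʳ)
open import Data.Product using (∃-syntax; _×_; _,_; proj₁; proj₂)
open import Data.Sum using (inj₁; inj₂)
open import Data.Empty using (⊥-elim)
open import Function using (_∘_)
open import Relation.Binary.PropositionalEquality
open import Relation.Nullary using (yes; no; Dec)
open import Relation.Nullary.Decidable using (_×-dec_)

sumℚ-zero : ∀ {k} (f : Fin k → ℚ) → (∀ j → f j ≡ 0ℚ) → sumℚ f ≡ 0ℚ
sumℚ-zero {zero}  f f≡0 = refl
sumℚ-zero {suc k} f f≡0
  rewrite f≡0 zero | sumℚ-zero (λ i → f (suc i)) (λ j → f≡0 (suc j)) = refl

sumℚ-single : ∀ {k} (f : Fin k → ℚ) (i : Fin k) → (∀ j → j ≢ i → f j ≡ 0ℚ) → sumℚ f ≡ f i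
sumℚ-single {suc k} f zero f≡0
  rewrite sumℚ-zero (λ i → f (suc i)) (λ j → f≡0 (suc j) (λ ())) = +-identityʳ (f zero)
sumℚ-single {suc k} f (suc i) f≡0 rewrite f≡0 zero (λ ()) =
  trans (+-identityˡ _)
        (sumℚ-single (λ j → f (suc j)) i (λ j j≢i → f≡0 (suc j) (j≢i ∘ suc-injective)))

module _ {n : ℕ} (G : PermGroup n) where
  open PermGroup G

  Agree : Fin m → Fin m → Set
  Agree g h = ∃[ ω ] elt g ω ≡ elt h ω

  agree-sym : ∀ {g h} → Agree g h → Agree h g
  agree-sym (ω , eq) = ω , sym eq

  _⁻¹ : Fin m → Fin m
  g ⁻¹ = proj₁ (hasInv g)

  ⁻¹-inverseˡ : ∀ g ω → elt (g ⁻¹) (elt g ω) ≡ ω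
  ⁻¹-inverseˡ g = proj₂ (hasInv g)

  -- x / y is x·y⁻¹ in the right-action convention: first x, then y⁻¹.
  _/_ : Fin m → Fin m → Fin m
  x / y = proj₁ (closed x (y ⁻¹))

  /-elt : ∀ x y ω → elt (x / y) ω ≡ elt (y ⁻¹) (elt x ω)
  /-elt x y = proj₂ (closed x (y ⁻¹))

  agree⇒fixes-/ : ∀ {x y} → Agree x y → FixesSomePoint G (x / y)
  agree⇒fixes-/ {x} {y} (ω , eq) = ω , (begin
    elt (x / y) ω          ≡⟨ /-elt x y ω ⟩
    elt (y ⁻¹) (elt x ω)   ≡⟨ cong (elt (y ⁻¹)) eq ⟩
    elt (y ⁻¹) (elt y ω)   ≡⟨ ⁻¹-inverseˡ y ω ⟩
    ω                      ∎)
    where open ≡-Reasoning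

  fixes-/⇒agree : ∀ {x y} → FixesSomePoint G (x / y) → Agree x y
  fixes-/⇒agree {x} {y} (ω , fix) = ω , isPerm (y ⁻¹) (begin
    elt (y ⁻¹) (elt x ω)   ≡⟨ sym (/-elt x y ω) ⟩
    elt (x / y) ω          ≡⟨ fix ⟩
    ω                      ≡⟨ sym (⁻¹-inverseˡ y ω) ⟩
    elt (y ⁻¹) (elt y ω)   ∎)
    where open ≡-Reasoning

  agree-/-cancelʳ : ∀ {x y z} → Agree (x / z) (y / z) → Agree x y
  agree-/-cancelʳ {x} {y} {z} (ω , eq) =
    ω , isPerm (z ⁻¹) (trans (sym (/-elt x z ω)) (trans eq (/-elt y z ω)))

  /-InH : ∀ {x y} → InH G x → InH G y → InH G (x / y)
  /-InH {x} {y} x∈H y∈H = mul x∈H (inv y∈H (⁻¹-inverseˡ y)) (/-elt x y)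

  fixesSomePoint? : ∀ g → Dec (FixesSomePoint G g)
  fixesSomePoint? g = any? (λ ω → elt g ω ≟ ω)

  module _ (noDerangement : HNoDerangement G) where

    InH⇒fixesSomePoint : ∀ {g} → InH G g → FixesSomePoint G g
    InH⇒fixesSomePoint {g} g∈H with fixesSomePoint? g
    ... | yes fix = fix
    ... | no  der = ⊥-elim (noDerangement g g∈H der)

    agree-trans : ∀ {f g h} → Agree f g → Agree g h → Agree f h
    agree-trans f~g g~h = agree-/-cancelʳ (fixes-/⇒agree (InH⇒fixesSomePoint
      (/-InH (gen (agree⇒fixes-/ f~g)) (gen (agree⇒fixes-/ (agree-sym g~h))))))

  module _ (agree-trans : ∀ {f g h} → Agree f g → Agree g h → Agree f h)
           {F : Subset m} (maxF : MaxIntersecting G F) where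

    private
      extend-intersecting : ∀ {g h} → g ∈ F → Agree g h → Intersecting G (F ∪ ⁅ h ⁆)
      extend-intersecting {g} {h} g∈F g~h x y x∈ y∈
        with x∈p∪q⁻ F ⁅ h ⁆ x∈ | x∈p∪q⁻ F ⁅ h ⁆ y∈
      ... | inj₁ x∈F | inj₁ y∈F = proj₁ maxF x y x∈F y∈F
      ... | inj₁ x∈F | inj₂ y∈h rewrite x∈⁅y⁆⇒x≡y h y∈h =
        agree-trans (proj₁ maxF x g x∈F g∈F) g~h
      ... | inj₂ x∈h | inj₁ y∈F rewrite x∈⁅y⁆⇒x≡y h x∈h =
        agree-trans (agree-sym g~h) (proj₁ maxF g y g∈F y∈F)
      ... | inj₂ x∈h | inj₂ y∈h rewrite x∈⁅y⁆⇒x≡y h x∈h | x∈⁅y⁆⇒x≡y h y∈h =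
        proj₁ g~h , refl

    maxIntersecting-agree-closed : ∀ {g h} → g ∈ F → Agree g h → h ∈ F
    maxIntersecting-agree-closed {g} {h} g∈F g~h with h ∈? F
    ... | yes h∈F = h∈F
    ... | no  h∉F = ⊥-elim (<⇒≱ F<F∪h (proj₂ maxF (F ∪ ⁅ h ⁆) (extend-intersecting g∈F g~h)))
      where
      F<F∪h : ∣ F ∣ < ∣ F ∪ ⁅ h ⁆ ∣
      F<F∪h = p⊂q⇒∣p∣<∣q∣ (p⊆p∪q ⁅ h ⁆ , h , x∈p∪q⁺ (inj₂ (x∈⁅x⁆ h)) , h∉F)

  canonVec-off : ∀ ω ω' g → ω' ≢ elt g ω → canonVec G ω ω' g ≡ 0ℚ
  canonVec-off ω ω' g ω'≢gω with elt g ω ≟ ω'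
  ... | yes gω≡ω' = ⊥-elim (ω'≢gω (sym gω≡ω'))
  ... | no  _     = refl

  canonVec-on : ∀ ω g → canonVec G ω (elt g ω) g ≡ 1ℚ
  canonVec-on ω g with elt g ω ≟ elt g ω
  ... | yes _   = refl
  ... | no  gω≢ = ⊥-elim (gω≢ refl)

  module _ (ω₀ : Fin n) (e : Fin n → ℚ) where

    concentratedAt : Fin n → Fin n → ℚ
    concentratedAt ω ω' with ω ≟ ω₀
    ... | yes _ = e ω'
    ... | no  _ = 0ℚ

    concentratedAt-on : ∀ ω' → concentratedAt ω₀ ω' ≡ e ω'
    concentratedAt-on ω' with ω₀ ≟ ω₀
    ... | yes _   = refl
    ... | no  ω₀≢ = ⊥-elim (ω₀≢ refl)

    concentratedAt-off : ∀ {ω} ω' → ω ≢ ω₀ → concentratedAt ω ω' ≡ 0ℚ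
    concentratedAt-off {ω} ω' ω≢ω₀ with ω ≟ ω₀
    ... | yes ω≡ω₀ = ⊥-elim (ω≢ω₀ ω≡ω₀)
    ... | no  _    = refl

    -- The coefficient matrix is supported on the row ω₀, and canonVec ω₀ · g
    -- on the single column ω₀^g, so the double sum collapses to e (ω₀^g).
    factorsThrough-InCanonicalSpan : ∀ {v} → (∀ g → v g ≡ e (elt g ω₀)) → InCanonicalSpan G v
    factorsThrough-InCanonicalSpan {v} v≡e = concentratedAt , λ g → begin
      v g                                    ≡⟨ v≡e g ⟩
      e (elt g ω₀)                           ≡˘⟨ concentratedAt-on (elt g ω₀) ⟩
      concentratedAt ω₀ (elt g ω₀)           ≡˘⟨ *-identityʳ _ ⟩
      concentratedAt ω₀ (elt g ω₀) * 1ℚ      ≡˘⟨ cong (concentratedAt ω₀ (elt g ω₀) *_) (canonVec-on ω₀ g) ⟩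
      term g ω₀ (elt g ω₀)                   ≡˘⟨ sumℚ-single (term g ω₀) (elt g ω₀) (term₀-off g) ⟩
      rowSum g ω₀                            ≡˘⟨ sumℚ-single (rowSum g) ω₀ (rowSum-off g) ⟩
      sumℚ (rowSum g)                        ∎
      where
      open ≡-Reasoning
      term : Fin m → Fin n → Fin n → ℚ
      term g ω ω' = concentratedAt ω ω' * canonVec G ω ω' g
      rowSum : Fin m → Fin n → ℚ
      rowSum g ω = sumℚ (term g ω)
      term₀-off : ∀ g ω' → ω' ≢ elt g ω₀ → term g ω₀ ω' ≡ 0ℚ
      term₀-off g ω' ω'≢ = trans (cong (concentratedAt ω₀ ω' *_) (canonVec-off ω₀ ω' g ω'≢))
                                 (*-zeroʳ (concentratedAt ω₀ ω'))
      rowSum-off : ∀ g ω → ω ≢ ω₀ → rowSum g ω ≡ 0ℚ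
      rowSum-off g ω ω≢ω₀ = sumℚ-zero (term g ω) λ ω' →
        trans (cong (_* canonVec G ω ω' g) (concentratedAt-off ω' ω≢ω₀)) (*-zeroˡ (canonVec G ω ω' g))

  module _ (F : Subset m) (ω₀ : Fin n) where

    hitsFrom? : ∀ ω' → Dec (∃[ g ] (g ∈ F × elt g ω₀ ≡ ω'))
    hitsFrom? ω' = any? (λ g → (g ∈? F) ×-dec (elt g ω₀ ≟ ω'))

    imageIndicator : Fin n → ℚ
    imageIndicator ω' with hitsFrom? ω'
    ... | yes _ = 1ℚ
    ... | no  _ = 0ℚ

    charVec-factorsThrough-image : (∀ {g h} → g ∈ F → elt g ω₀ ≡ elt h ω₀ → h ∈ F) →
                                   ∀ g → charVec G F g ≡ imageIndicator (elt g ω₀)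
    charVec-factorsThrough-image closedF g with g ∈? F | hitsFrom? (elt g ω₀)
    ... | yes _   | yes _              = refl
    ... | no  _   | no  _              = refl
    ... | yes g∈F | no  ¬hit           = ⊥-elim (¬hit (g , g∈F , refl))
    ... | no  g∉F | yes (h , h∈F , eq) = ⊥-elim (g∉F (closedF h∈F eq))

charVec-no-points : (G : PermGroup 0) {F : Subset (PermGroup.m G)} →
                    Intersecting G F → ∀ g → charVec G F g ≡ 0ℚ
charVec-no-points G {F} intF g with g ∈? F
... | yes g∈F with intF g g g∈F g∈F
...   | () , _
charVec-no-points G {F} intF g | no _ = refl

theorem5p2 : (n : ℕ) (G : PermGroup n) → Transitive G → ProperH G → HNoDerangement G → EKRModule G
theorem5p2 zero    G _ _ _ F maxF = (λ ()) , charVec-no-points G (proj₁ maxF)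
theorem5p2 (suc n) G _ _ noDerangement F maxF =
  factorsThrough-InCanonicalSpan G zero (imageIndicator G F zero)
    (charVec-factorsThrough-image G F zero closedF)
  where
  open PermGroup G
  closedF : ∀ {g h} → g ∈ F → elt g zero ≡ elt h zero → h ∈ F
  closedF g∈F eq = maxIntersecting-agree-closed G (agree-trans G noDerangement) maxF g∈F (zero , eq)
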